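{- Let $Q(u,v)\in\mathbb{Z}[u,v]$ be a quadratic form and let $r\in\mathbb{N}$. Then there are lattices $\Lambda_1,\ldots,\Lambda_N\subseteq\mathbb{Z}^2$ with $N\le 2^{\Omega(r)}$ such that, for $(u,v)\in\mathbb{Z}^2$, one has $Q(u,v)\equiv 0 \pmod r$ if and only if $(u,v)\in\bigcup_{n=1}^N\Lambda_n$.
   Context: $\Omega(r)$ denotes the number of prime factors of $r$ counted with multiplicity. -}

module Defs where

open import Data.Nat as ℕ using (ℕ; zero; suc; _≤?_; _/_)
open import Data.Nat.Divisibility using (_∣?_)
open import Data.Integer using (ℤ; _+_; _*_; _-_; 0ℤ)
open import Data.Product using (_×_; _,_; ∃₂)
open import Relation.Binary.PropositionalEquality using (_≡_; _≢_)
open import Relation.Nullary using (yes; no)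

-- Ω(n): number of prime factors of n counted with multiplicity,
-- computed by trial division.  ΩAux fuel n k tries the divisor d = k + 2.
-- Fuel 2n suffices: at most n increments of d and at most log₂ n divisions.
ΩAux : ℕ → ℕ → ℕ → ℕ
ΩAux zero n k = 0
ΩAux (suc f) n k with n ≤? 1
... | yes _ = 0
... | no _ with suc (suc k) ∣? n
...   | yes _ = suc (ΩAux f (n / suc (suc k)) k)
...   | no _  = ΩAux f n (suc k)

Ω : ℕ → ℕ
Ω n = ΩAux (2 ℕ.* n) n 0

record QuadForm : Set where
  constructor qf
  field
    a b c : ℤ

evalQ : QuadForm → ℤ → ℤ → ℤ
evalQ (qf a b c) u v = a * u * u + b * u * v + c * v * v

record Lattice : Set where
  constructor lattice
  field
    w₁ w₂ : ℤ × ℤ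
    independent : let (x₁ , y₁) = w₁ ; (x₂ , y₂) = w₂ in x₁ * y₂ - x₂ * y₁ ≢ 0ℤ

_∈L_ : ℤ × ℤ → Lattice → Set
(u , v) ∈L lattice (x₁ , y₁) (x₂ , y₂) _ =
  ∃₂ λ (m n : ℤ) → (u ≡ m * x₁ + n * x₂) × (v ≡ m * y₁ + n * y₂)

-- Peel off one prime factor of r at a time.  Modulo a prime p, the form Q either has a projective
-- zero (p ∣ c, or p ∣ Q(1,t) for some t) and then splits mod p into a product of two linear forms,
-- each of whose zero sets is a lattice or all of ℤ²; or it has none, and then p ∣ Q(u,v) forces
-- p ∣ u and p ∣ v.  Either way {p ∣ Q} is a union of at most two lattices M.  Each M is the image
-- of ℤ² under a linear map, and p divides every value of Q ∘ M, so Q ∘ M = p Q′ and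
-- p k ∣ Q(M y) iff k ∣ Q′(y).  Covering {k ∣ Q′} by induction and pushing those lattices forward
-- along M covers {p k ∣ Q} by at most 2 · 2^Ω(k) lattices.
module Submission where

open import Defs
open import Data.Nat using (ℕ; _≤_; _^_; NonZero)
open import Data.Integer using (ℤ; +_)
open import Data.Integer.Divisibility using (_∣_)
open import Data.List using (List; length)
open import Data.List.Relation.Unary.Any using (Any)
open import Data.Product using (Σ; _×_; _,_)
open import Function.Bundles using (_⇔_)

open import Data.Empty using (⊥-elim)
open import Data.Integer as ℤ using (_+_; _*_; _-_; -_; 0ℤ; 1ℤ)
import Data.Integer.DivMod as ℤ
import Data.Integer.Properties as ℤ
open import Data.Integer.Divisibility.Signed as ∣ₛ
  using (divides; ∣ᵤ⇒∣; ∣⇒∣ᵤ; ∣m∣n⇒∣m+n; ∣m∣n⇒∣m-n; ∣m+n∣m⇒∣n; ∣m+n∣n⇒∣m; ∣m⇒∣m*n; ∣n⇒∣m*n)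
  renaming (_∣_ to _∣ₛ_)
open import Data.Integer.Tactic.RingSolver using (solve; solve-∀)
open import Data.List as List using ([]; _∷_; _++_)
import Data.List.Properties as List
open import Data.List.Relation.Unary.Any as Any using (here; there)
open import Data.List.Relation.Unary.Any.Properties using (map⁺; ++↔; singleton⁻)
open import Data.Nat as ℕ using (zero; suc; _<_; _/_)
import Data.Nat.Divisibility as ℕ
open import Data.Nat.Coprimality using (prime⇒coprime; coprime-Bézout)
open import Data.Nat.DivMod using (m*[n/m]≡n; m/n<m; m≥n⇒m/n>0)
open import Data.Nat.GCD using (module Bézout)
open import Data.Nat.Primality
  using (Prime; _Rough_; 2-rough; rough⇒≤; rough∧∣⇒prime; rough∧∣⇒rough; ∤⇒rough-suc; euclidsLemma;
         prime⇒nonZero)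
import Data.Nat.Properties as ℕ
open import Data.Nat.Properties using (anyUpTo?)
open import Data.Product as Product using (∃; proj₁; proj₂)
open import Data.Sum as Sum using (_⊎_; inj₁; inj₂; [_,_])
open import Data.Sum.Function.Propositional using (_⊎-⇔_)
open import Function.Base using (_∘_)
open import Function.Bundles using (mk⇔; Equivalence)
open import Function.Properties.Equivalence using () renaming (sym to ⇔-sym; trans to ⇔-trans)
open import Function.Properties.Inverse using (↔⇒⇔)
open import Relation.Binary.PropositionalEquality
  using (_≡_; _≢_; refl; sym; trans; cong; cong₂; subst; subst₂; module ≡-Reasoning)
open import Relation.Nullary using (¬_; yes; no)

open Equivalence using (to; from)

private
  variable
    m n : ℕ
    P R : ℤ × ℤ → Set

-- Lattices as linear maps

det : ℤ × ℤ → ℤ × ℤ → ℤ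
det (x₁ , y₁) (x₂ , y₂) = x₁ * y₂ - x₂ * y₁

infixl 30 _⟨_⟩
_⟨_⟩ : Lattice → ℤ × ℤ → ℤ × ℤ
lattice (x₁ , y₁) (x₂ , y₂) _ ⟨ m , n ⟩ = m * x₁ + n * x₂ , m * y₁ + n * y₂

⟨⟩∈L : ∀ M y → M ⟨ y ⟩ ∈L M
⟨⟩∈L (lattice _ _ _) (m , n) = m , n , refl , refl

∈L⇒⟨⟩ : ∀ M {x} → x ∈L M → ∃ λ y → x ≡ M ⟨ y ⟩
∈L⇒⟨⟩ (lattice _ _ _) (m , n , refl , refl) = (m , n) , refl

-- Abstract because _∘ᴸ_ stores this ring-solver proof in the lattice it builds: when Agda unfolds
-- it while comparing lattices, checking exhausts memory.
abstract
  det-⟨⟩ : ∀ M y z → det (M ⟨ y ⟩) (M ⟨ z ⟩) ≡ det (Lattice.w₁ M) (Lattice.w₂ M) * det y z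
  det-⟨⟩ (lattice (x₁ , y₁) (x₂ , y₂) _) (m₁ , n₁) (m₂ , n₂) = expand x₁ y₁ x₂ y₂ m₁ n₁ m₂ n₂
    where
    expand : ∀ x₁ y₁ x₂ y₂ m₁ n₁ m₂ n₂ →
      (m₁ * x₁ + n₁ * x₂) * (m₂ * y₁ + n₂ * y₂) - (m₂ * x₁ + n₂ * x₂) * (m₁ * y₁ + n₁ * y₂)
        ≡ (x₁ * y₂ - x₂ * y₁) * (m₁ * n₂ - m₂ * n₁)
    expand = solve-∀

infixr 30 _∘ᴸ_
_∘ᴸ_ : Lattice → Lattice → Lattice
M ∘ᴸ lattice w₁ w₂ independent = lattice (M ⟨ w₁ ⟩) (M ⟨ w₂ ⟩) λ det≡0 →
  [ Lattice.independent M , independent ] (ℤ.i*j≡0⇒i≡0∨j≡0 _ (trans (sym (det-⟨⟩ M w₁ w₂)) det≡0))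

⟨⟩-∘ᴸ : ∀ M Λ y → (M ∘ᴸ Λ) ⟨ y ⟩ ≡ M ⟨ Λ ⟨ y ⟩ ⟩
⟨⟩-∘ᴸ (lattice (x₁ , y₁) (x₂ , y₂) _) (lattice (p₁ , q₁) (p₂ , q₂) _) (m , n) =
  cong₂ _,_ (linear x₁ x₂ p₁ q₁ p₂ q₂ m n) (linear y₁ y₂ p₁ q₁ p₂ q₂ m n)
  where
  linear : ∀ x₁ x₂ p₁ q₁ p₂ q₂ m n → m * (p₁ * x₁ + q₁ * x₂) + n * (p₂ * x₁ + q₂ * x₂)
                                   ≡ (m * p₁ + n * p₂) * x₁ + (m * q₁ + n * q₂) * x₂
  linear = solve-∀

∈L-∘ᴸ⁺ : ∀ M Λ {y} → y ∈L Λ → M ⟨ y ⟩ ∈L M ∘ᴸ Λ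
∈L-∘ᴸ⁺ M Λ y∈Λ with ∈L⇒⟨⟩ Λ y∈Λ
... | z , refl = subst (_∈L M ∘ᴸ Λ) (⟨⟩-∘ᴸ M Λ z) (⟨⟩∈L (M ∘ᴸ Λ) z)

∈L-∘ᴸ⁻ : ∀ M Λ {x} → x ∈L M ∘ᴸ Λ → ∃ λ y → y ∈L Λ × x ≡ M ⟨ y ⟩
∈L-∘ᴸ⁻ M Λ x∈ with ∈L⇒⟨⟩ (M ∘ᴸ Λ) x∈
... | z , refl = Λ ⟨ z ⟩ , ⟨⟩∈L Λ z , ⟨⟩-∘ᴸ M Λ z

triangular : ∀ a s d → a ≢ 0ℤ → d ≢ 0ℤ → Lattice
triangular a s d a≢0 d≢0 = lattice (a , s) (0ℤ , d) λ det≡0 →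
  [ a≢0 , d≢0 ] (ℤ.i*j≡0⇒i≡0∨j≡0 a (trans (sym (det≡a*d a s d)) det≡0))
  where
  det≡a*d : ∀ a s d → a * d - 0ℤ * s ≡ a * d
  det≡a*d = solve-∀

∈-triangular : ∀ {a s d} a≢0 d≢0 {u v} →
               (u , v) ∈L triangular a s d a≢0 d≢0 ⇔ (∃ λ m → u ≡ m * a × d ∣ₛ v - m * s)
∈-triangular {a} {s} {d} _ _ {u} {v} = mk⇔
  (λ (m , n , u≡ , v≡) →
    m , trans u≡ (drop-n a m n) , divides n (trans (cong (_- m * s) v≡) (cancel-m s d m n)))
  (λ (m , u≡ , divides n v-ms≡) → m , n , trans u≡ (sym (drop-n a m n)) , (begin
    v                   ≡⟨ split v (m * s) ⟩
    m * s + (v - m * s) ≡⟨ cong (λ z → m * s + z) v-ms≡ ⟩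
    m * s + n * d       ∎))
  where
  open ≡-Reasoning
  drop-n : ∀ a m n → m * a + n * 0ℤ ≡ m * a
  drop-n = solve-∀
  cancel-m : ∀ s d m n → m * s + n * d - m * s ≡ n * d
  cancel-m = solve-∀
  split : ∀ v w → v ≡ w + (v - w)
  split = solve-∀

-- Covers of subsets of ℤ² by finitely many lattices

infix 4 _∈ᴸ_
_∈ᴸ_ : ℤ × ℤ → List Lattice → Set
x ∈ᴸ Λs = Any (x ∈L_) Λs

∈ᴸ-map-∘ᴸ⁻ : ∀ M Λs {x} → x ∈ᴸ List.map (M ∘ᴸ_) Λs → ∃ λ y → y ∈ᴸ Λs × x ≡ M ⟨ y ⟩
∈ᴸ-map-∘ᴸ⁻ M (Λ ∷ _)  (here x∈)  = Product.map₂ (Product.map₁ here) (∈L-∘ᴸ⁻ M Λ x∈)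
∈ᴸ-map-∘ᴸ⁻ M (_ ∷ Λs) (there x∈) = Product.map₂ (Product.map₁ there) (∈ᴸ-map-∘ᴸ⁻ M Λs x∈)

record Cover (P : ℤ × ℤ → Set) (n : ℕ) : Set where
  constructor cover
  field
    lattices : List Lattice
    length≤  : length lattices ≤ n
    spec     : ∀ x → P x ⇔ x ∈ᴸ lattices

Cover-resp-⇔ : (∀ x → P x ⇔ R x) → Cover P n → Cover R n
Cover-resp-⇔ P⇔R (cover Λs length≤ spec) = cover Λs length≤ λ x → ⇔-trans (⇔-sym (P⇔R x)) (spec x)

Cover-weaken : m ≤ n → Cover P m → Cover P n
Cover-weaken m≤n (cover Λs length≤ spec) = cover Λs (ℕ.≤-trans length≤ m≤n) spec

cover-lattice : ∀ Λ → (∀ x → P x ⇔ x ∈L Λ) → Cover P 1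
cover-lattice Λ spec = cover (Λ ∷ []) ℕ.≤-refl λ x → ⇔-trans (spec x) (mk⇔ here singleton⁻)

cover-triangular : ∀ {a s d} → a ≢ 0ℤ → d ≢ 0ℤ →
                   (∀ u v → P (u , v) ⇔ (∃ λ m → u ≡ m * a × d ∣ₛ v - m * s)) → Cover P 1
cover-triangular a≢0 d≢0 P⇔ = cover-lattice (triangular _ _ _ a≢0 d≢0) λ (u , v) →
  ⇔-trans (P⇔ u v) (⇔-sym (∈-triangular a≢0 d≢0))

cover-diagonal : ∀ {a d} → a ≢ 0ℤ → d ≢ 0ℤ → (∀ u v → P (u , v) ⇔ (a ∣ₛ u × d ∣ₛ v)) → Cover P 1
cover-diagonal {a = a} {d} a≢0 d≢0 P⇔ = cover-triangular a≢0 d≢0 λ u v → ⇔-trans (P⇔ u v) (mk⇔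
  (λ (divides m u≡ , d∣v) → m , u≡ , subst (d ∣ₛ_) (sym (v-m*0≡v v m)) d∣v)
  (λ (m , u≡ , d∣) → divides m u≡ , subst (d ∣ₛ_) (v-m*0≡v v m) d∣))
  where
  v-m*0≡v : ∀ v m → v - m * 0ℤ ≡ v
  v-m*0≡v = solve-∀

1∣ : ∀ z → 1ℤ ∣ₛ z
1∣ z = ∣ᵤ⇒∣ (ℕ.1∣ ℤ.∣ z ∣)

cover-everything : (∀ x → P x) → Cover P 1
cover-everything P-all = cover-diagonal (λ ()) (λ ()) λ u v →
  mk⇔ (λ _ → 1∣ u , 1∣ v) (λ _ → P-all (u , v))

cover-∪ : Cover P m → Cover R n → Cover (λ x → P x ⊎ R x) (m ℕ.+ n)
cover-∪ (cover Λs length≤ spec) (cover Λs′ length≤′ spec′) =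
  cover (Λs ++ Λs′) length≤″ λ x → ⇔-trans (spec x ⊎-⇔ spec′ x) (↔⇒⇔ ++↔)
  where
  length≤″ : length (Λs ++ Λs′) ≤ _
  length≤″ = subst (_≤ _) (sym (List.length-++ Λs)) (ℕ.+-mono-≤ length≤ length≤′)

cover-⋃ : ∀ Ms → (∀ M → (∀ x → x ∈L M → P x) → Cover (λ x → x ∈L M × R x) n) →
          (∀ x → x ∈ᴸ Ms → P x) → Cover (λ x → x ∈ᴸ Ms × R x) (length Ms ℕ.* n)
cover-⋃ [] _ _ = cover [] ℕ.z≤n λ x → mk⇔ (λ ()) (λ ())
cover-⋃ {R = R} (M ∷ Ms) cover-on Ms⊆P = Cover-resp-⇔ split (cover-∪
  (cover-on M λ x → Ms⊆P x ∘ here)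
  (cover-⋃ Ms cover-on λ x → Ms⊆P x ∘ there))
  where
  split : ∀ x → ((x ∈L M × R x) ⊎ (x ∈ᴸ Ms × R x)) ⇔ (x ∈ᴸ M ∷ Ms × R x)
  split x = mk⇔ [ Product.map₁ here , Product.map₁ there ] λ where
    (here x∈M , r)   → inj₁ (x∈M , r)
    (there x∈Ms , r) → inj₂ (x∈Ms , r)

cover-restrict : ∀ M → Cover (λ y → P (M ⟨ y ⟩)) n → Cover (λ x → x ∈L M × P x) n
cover-restrict {P = P} M (cover Λs length≤ spec) =
  cover (List.map (M ∘ᴸ_) Λs) (subst (_≤ _) (sym (List.length-map _ Λs)) length≤) λ x →
    mk⇔ (into x) (outof x)
  where
  into : ∀ x → x ∈L M × P x → x ∈ᴸ List.map (M ∘ᴸ_) Λs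
  into x (x∈M , Px) with ∈L⇒⟨⟩ M x∈M
  ... | y , refl = map⁺ (Any.map (λ {Λ} → ∈L-∘ᴸ⁺ M Λ) (to (spec y) Px))
  outof : ∀ x → x ∈ᴸ List.map (M ∘ᴸ_) Λs → x ∈L M × P x
  outof x x∈ with ∈ᴸ-map-∘ᴸ⁻ M Λs x∈
  ... | y , y∈Λs , refl = ⟨⟩∈L M y , from (spec y) y∈Λs

infix 30 _⟦_⟧
_⟦_⟧ : QuadForm → ℤ × ℤ → ℤ
Q ⟦ u , v ⟧ = evalQ Q u v

polar : QuadForm → ℤ × ℤ → ℤ × ℤ → ℤ
polar (qf a b c) (x₁ , y₁) (x₂ , y₂) = + 2 * a * x₁ * x₂ + b * (x₁ * y₂ + x₂ * y₁) + + 2 * c * y₁ * y₂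

infixl 30 _∘Q_
_∘Q_ : QuadForm → Lattice → QuadForm
Q ∘Q lattice w₁ w₂ _ = qf (Q ⟦ w₁ ⟧) (polar Q w₁ w₂) (Q ⟦ w₂ ⟧)

∘Q-⟦⟧ : ∀ Q M y → Q ∘Q M ⟦ y ⟧ ≡ Q ⟦ M ⟨ y ⟩ ⟧
∘Q-⟦⟧ (qf a b c) (lattice (x₁ , y₁) (x₂ , y₂) _) (m , n) = expand a b c x₁ y₁ x₂ y₂ m n
  where
  expand : ∀ a b c x₁ y₁ x₂ y₂ m n →
    (a * x₁ * x₁ + b * x₁ * y₁ + c * y₁ * y₁) * m * m
      + (+ 2 * a * x₁ * x₂ + b * (x₁ * y₂ + x₂ * y₁) + + 2 * c * y₁ * y₂) * m * n
      + (a * x₂ * x₂ + b * x₂ * y₂ + c * y₂ * y₂) * n * n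
    ≡ a * (m * x₁ + n * x₂) * (m * x₁ + n * x₂) + b * (m * x₁ + n * x₂) * (m * y₁ + n * y₂)
      + c * (m * y₁ + n * y₂) * (m * y₁ + n * y₂)
  expand = solve-∀

∣-coefficients⇒multiple : ∀ {k a b c} → k ∣ₛ a → k ∣ₛ b → k ∣ₛ c →
                          ∃ λ Q′ → ∀ y → qf a b c ⟦ y ⟧ ≡ k * Q′ ⟦ y ⟧
∣-coefficients⇒multiple {k} (divides a′ refl) (divides b′ refl) (divides c′ refl) =
  qf a′ b′ c′ , λ (u , v) → factor a′ b′ c′ k u v
  where
  factor : ∀ a b c k u v →
    a * k * u * u + b * k * u * v + c * k * v * v ≡ k * (a * u * u + b * u * v + c * v * v)
  factor = solve-∀

∣-values⇒multiple : ∀ {k} Q → (∀ y → k ∣ₛ Q ⟦ y ⟧) → ∃ λ Q′ → ∀ y → Q ⟦ y ⟧ ≡ k * Q′ ⟦ y ⟧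
∣-values⇒multiple {k} (qf a b c) k∣Q = ∣-coefficients⇒multiple k∣a k∣b k∣c
  where
  Q[1,0]≡a : ∀ a b c → a * 1ℤ * 1ℤ + b * 1ℤ * 0ℤ + c * 0ℤ * 0ℤ ≡ a
  Q[1,0]≡a = solve-∀
  Q[0,1]≡c : ∀ a b c → a * 0ℤ * 0ℤ + b * 0ℤ * 1ℤ + c * 1ℤ * 1ℤ ≡ c
  Q[0,1]≡c = solve-∀
  Q[1,1]-a-c≡b : ∀ a b c → a * 1ℤ * 1ℤ + b * 1ℤ * 1ℤ + c * 1ℤ * 1ℤ - a - c ≡ b
  Q[1,1]-a-c≡b = solve-∀
  k∣a = subst (k ∣ₛ_) (Q[1,0]≡a a b c) (k∣Q (1ℤ , 0ℤ))
  k∣c = subst (k ∣ₛ_) (Q[0,1]≡c a b c) (k∣Q (0ℤ , 1ℤ))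
  k∣b = subst (k ∣ₛ_) (Q[1,1]-a-c≡b a b c) (∣m∣n⇒∣m-n (∣m∣n⇒∣m-n (k∣Q (1ℤ , 1ℤ)) k∣a) k∣c)

∣-arguments⇒∣-value : ∀ {k} Q {u v} → k ∣ₛ u → k ∣ₛ v → k ∣ₛ Q ⟦ u , v ⟧
∣-arguments⇒∣-value (qf a b c) {u} {v} k∣u k∣v =
  ∣m∣n⇒∣m+n (∣m∣n⇒∣m+n (∣n⇒∣m*n (a * u) k∣u) (∣n⇒∣m*n (b * u) k∣v)) (∣n⇒∣m*n (c * v) k∣v)

infix 30 _∙_
_∙_ : ℤ × ℤ → ℤ × ℤ → ℤ
(α , β) ∙ (u , v) = α * u + β * v

∣-resp-≡mod : ∀ {d a b} → d ∣ₛ a - b → d ∣ₛ a ⇔ d ∣ₛ b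
∣-resp-≡mod {d} {a} {b} d∣a-b = mk⇔
  (λ d∣a → ∣m+n∣m⇒∣n (subst (d ∣ₛ_) (sym (a-b+b≡a a b)) d∣a) d∣a-b)
  (λ d∣b → subst (d ∣ₛ_) (a-b+b≡a a b) (∣m∣n⇒∣m+n d∣a-b d∣b))
  where
  a-b+b≡a : ∀ a b → a - b + b ≡ a
  a-b+b≡a = solve-∀

pos-1+*≡* : ∀ a b c d → 1 ℕ.+ a ℕ.* b ≡ c ℕ.* d → 1ℤ + + a * + b ≡ + c * + d
pos-1+*≡* a b c d eq = begin
  1ℤ + + a * + b    ≡⟨ cong (λ z → 1ℤ + z) (ℤ.pos-* a b) ⟨
  + (1 ℕ.+ a ℕ.* b) ≡⟨ cong +_ eq ⟩
  + (c ℕ.* d)       ≡⟨ ℤ.pos-* c d ⟩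
  + c * + d         ∎
  where open ≡-Reasoning

-- Zero sets modulo a prime

module _ {p : ℕ} (p-prime : Prime p) where

  private
    instance
      +p-nonZero : ℤ.NonZero (+ p)
      +p-nonZero = prime⇒nonZero p-prime

    +p≢0 : + p ≢ 0ℤ
    +p≢0 = ℕ.≢-nonZero⁻¹ p {{prime⇒nonZero p-prime}} ∘ ℤ.+-injective

  euclidsLemmaℤ : ∀ x y → + p ∣ₛ x * y → + p ∣ₛ x ⊎ + p ∣ₛ y
  euclidsLemmaℤ x y p∣xy = Sum.map ∣ᵤ⇒∣ ∣ᵤ⇒∣
    (euclidsLemma ℤ.∣ x ∣ ℤ.∣ y ∣ p-prime (subst (p ℕ.∣_) (ℤ.abs-* x y) (∣⇒∣ᵤ p∣xy)))

  ∣-square⇒∣ : ∀ x → + p ∣ₛ x * x → + p ∣ₛ x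
  ∣-square⇒∣ x = Sum.reduce ∘ euclidsLemmaℤ x x

  ∣x*y∧∤x⇒∣y : ∀ {x y} → ¬ + p ∣ₛ x → + p ∣ₛ x * y → + p ∣ₛ y
  ∣x*y∧∤x⇒∣y {x} {y} p∤x = Sum.fromInj₂ (⊥-elim ∘ p∤x) ∘ euclidsLemmaℤ x y

  -- Abstract because only the specifications of these witnesses matter: letting Agda unfold the
  -- division and Bézout computations during with-abstraction exhausts memory.
  abstract
    reduce-mod : ∀ w → ∃ λ t → t < p × + p ∣ₛ w - + t
    reduce-mod w = w ℤ.% + p , ℤ.n%d<d w (+ p) , divides (w ℤ./ + p)
      (trans (cong (_- + (w ℤ.% + p)) (ℤ.a≡a%n+[a/n]*n w (+ p))) (t+x-t≡x (+ (w ℤ.% + p)) _))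
      where
      t+x-t≡x : ∀ t x → t + x - t ≡ x
      t+x-t≡x = solve-∀

    inverse-residue : ∀ {r} → 0 < r → r < p → ∃ λ z → + p ∣ₛ + r * z - 1ℤ
    inverse-residue {r} 0<r r<p with coprime-Bézout (prime⇒coprime p-prime {{ℕ.>-nonZero 0<r}} r<p)
    ... | Bézout.+- x y eq = - + y , divides (- + x) (begin
      + r * - + y - 1ℤ     ≡⟨ negate (+ r) (+ y) ⟩
      - (1ℤ + + y * + r)   ≡⟨ cong -_ (pos-1+*≡* y r x p eq) ⟩
      - (+ x * + p)        ≡⟨ ℤ.neg-distribˡ-* (+ x) (+ p) ⟩
      - + x * + p          ∎)
      where
      open ≡-Reasoning
      negate : ∀ r y → r * - y - 1ℤ ≡ - (1ℤ + y * r)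
      negate = solve-∀
    ... | Bézout.-+ x y eq = + y , divides (+ x) (begin
      + r * + y - 1ℤ       ≡⟨ cong (_- 1ℤ) (ℤ.*-comm (+ r) (+ y)) ⟩
      + y * + r - 1ℤ       ≡⟨ cong (_- 1ℤ) (sym (pos-1+*≡* x p y r eq)) ⟩
      1ℤ + + x * + p - 1ℤ  ≡⟨ 1+z-1≡z (+ x * + p) ⟩
      + x * + p            ∎)
      where
      open ≡-Reasoning
      1+z-1≡z : ∀ z → 1ℤ + z - 1ℤ ≡ z
      1+z-1≡z = solve-∀

    inverse-mod : ∀ {u} → ¬ + p ∣ₛ u → ∃ λ u′ → + p ∣ₛ u * u′ - 1ℤ
    inverse-mod {u} p∤u with reduce-mod u
    ... | r , r<p , p∣u-r with inverse-residue (ℕ.n≢0⇒n>0 r≢0) r<p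
      where
      r≢0 : r ≢ 0
      r≢0 refl = p∤u (subst (+ p ∣ₛ_) (ℤ.+-identityʳ u) p∣u-r)
    ...   | z , p∣rz-1 = z , subst (+ p ∣ₛ_) (shift u (+ r) z) (∣m∣n⇒∣m+n p∣rz-1 (∣m⇒∣m*n z p∣u-r))
      where
      shift : ∀ u r z → r * z - 1ℤ + (u - r) * z ≡ u * z - 1ℤ
      shift = solve-∀

    linear-congruence : ∀ {u} → ¬ + p ∣ₛ u → ∀ v → ∃ λ t → t < p × + p ∣ₛ u * + t - v
    linear-congruence {u} p∤u v =
      let u′ , p∣uu′-1      = inverse-mod p∤u
          t , t<p , p∣vu′-t = reduce-mod (v * u′)
      in t , t<p , subst (+ p ∣ₛ_) (combine u u′ v (+ t))
                     (∣m∣n⇒∣m-n (∣n⇒∣m*n v p∣uu′-1) (∣n⇒∣m*n u p∣vu′-t))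
      where
      combine : ∀ u u′ v t → v * (u * u′ - 1ℤ) - u * (v * u′ - t) ≡ u * t - v
      combine = solve-∀

  linear-cover-invertible : ∀ α {β} → ¬ + p ∣ₛ β → Cover (λ x → + p ∣ₛ (α , β) ∙ x) 1
  linear-cover-invertible α {β} p∤β with linear-congruence p∤β (- α)
  ... | s , _ , p∣βs+α = cover-triangular (λ ()) +p≢0 λ u v → mk⇔ (into u v) (outof u v)
    where
    into : ∀ u v → + p ∣ₛ α * u + β * v → ∃ λ m → u ≡ m * 1ℤ × + p ∣ₛ v - m * + s
    into u v p∣ = u , sym (ℤ.*-identityʳ u) , ∣x*y∧∤x⇒∣y p∤β p∣β[v-us]
      where
      eliminate : ∀ α β u v s → α * u + β * v - u * (β * s - - α) ≡ β * (v - u * s)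
      eliminate = solve-∀
      p∣β[v-us] : + p ∣ₛ β * (v - u * + s)
      p∣β[v-us] = subst (+ p ∣ₛ_) (eliminate α β u v (+ s)) (∣m∣n⇒∣m-n p∣ (∣n⇒∣m*n u p∣βs+α))
    outof : ∀ u v → (∃ λ m → u ≡ m * 1ℤ × + p ∣ₛ v - m * + s) → + p ∣ₛ α * u + β * v
    outof u v (m , u≡ , p∣v-ms) = subst (+ p ∣ₛ_) (recombine α β m u v (+ s) u≡)
      (∣m∣n⇒∣m+n (∣n⇒∣m*n β p∣v-ms) (∣n⇒∣m*n m p∣βs+α))
      where
      recombine : ∀ α β m u v s → u ≡ m * 1ℤ → β * (v - m * s) + m * (β * s - - α) ≡ α * u + β * v
      recombine α β m u v s refl = solve (α ∷ β ∷ m ∷ v ∷ s ∷ [])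

  linear-cover : ∀ w → Cover (λ x → + p ∣ₛ w ∙ x) 1
  linear-cover (α , β) with + p ∣ₛ.∣? β
  ... | no p∤β = linear-cover-invertible α p∤β
  ... | yes p∣β with + p ∣ₛ.∣? α
  ...   | yes p∣α = cover-everything λ (u , v) → ∣m∣n⇒∣m+n (∣m⇒∣m*n u p∣α) (∣m⇒∣m*n v p∣β)
  ...   | no p∤α = cover-diagonal +p≢0 (λ ()) λ u v → mk⇔ (into u v) (outof u v)
    where
    into : ∀ u v → + p ∣ₛ α * u + β * v → + p ∣ₛ u × 1ℤ ∣ₛ v
    into u v p∣ = ∣x*y∧∤x⇒∣y p∤α (∣m+n∣n⇒∣m p∣ (∣m⇒∣m*n v p∣β)) , 1∣ v
    outof : ∀ u v → + p ∣ₛ u × 1ℤ ∣ₛ v → + p ∣ₛ α * u + β * v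
    outof u v (p∣u , _) = ∣m∣n⇒∣m+n (∣n⇒∣m*n α p∣u) (∣m⇒∣m*n v p∣β)

  product-cover : ∀ Q w w′ → (∀ x → + p ∣ₛ Q ⟦ x ⟧ - (w ∙ x) * (w′ ∙ x)) →
                  Cover (λ x → + p ∣ₛ Q ⟦ x ⟧) 2
  product-cover Q w w′ p∣Q-ww′ =
    Cover-resp-⇔ (λ x → ⇔-sym (p∣Q⇔ x)) (cover-∪ (linear-cover w) (linear-cover w′))
    where
    p∣Q⇔ : ∀ x → + p ∣ₛ Q ⟦ x ⟧ ⇔ (+ p ∣ₛ w ∙ x ⊎ + p ∣ₛ w′ ∙ x)
    p∣Q⇔ x = ⇔-trans (∣-resp-≡mod (p∣Q-ww′ x))
      (mk⇔ (euclidsLemmaℤ (w ∙ x) (w′ ∙ x)) [ ∣m⇒∣m*n (w′ ∙ x) , ∣n⇒∣m*n (w ∙ x) ])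

  ∣-anisotropic⇒∣-arguments : ∀ {a b c} → ¬ + p ∣ₛ c →
                              ¬ (∃ λ t → t < p × + p ∣ₛ qf a b c ⟦ 1ℤ , + t ⟧) →
                              ∀ {u v} → + p ∣ₛ qf a b c ⟦ u , v ⟧ → + p ∣ₛ u × + p ∣ₛ v
  ∣-anisotropic⇒∣-arguments {a} {b} {c} p∤c no-root {u} {v} p∣Q with + p ∣ₛ.∣? u
  ... | yes p∣u@(divides q refl) = p∣u , ∣-square⇒∣ v (∣x*y∧∤x⇒∣y p∤c p∣c[vv])
    where
    expand : ∀ a b c q v P →
      a * (q * P) * (q * P) + b * (q * P) * v + c * v * v ≡ (a * q * q * P + b * q * v) * P + c * (v * v)
    expand = solve-∀
    p∣c[vv] : + p ∣ₛ c * (v * v)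
    p∣c[vv] = ∣m+n∣m⇒∣n (subst (+ p ∣ₛ_) (expand a b c q v (+ p)) p∣Q)
                        (∣n⇒∣m*n (a * q * q * + p + b * q * v) ∣ₛ.∣-refl)
  ... | no p∤u with linear-congruence p∤u v
  ...   | t , t<p , p∣ut-v = ⊥-elim (no-root (t , t<p , ∣x*y∧∤x⇒∣y (p∤u ∘ ∣-square⇒∣ u) p∣uuQ[1,t]))
    where
    complete-square : ∀ a b c u v t →
      a * u * u + b * u * v + c * v * v + (u * t - v) * (b * u + c * (u * t + v))
        ≡ u * u * (a * 1ℤ * 1ℤ + b * 1ℤ * t + c * t * t)
    complete-square = solve-∀
    p∣uuQ[1,t] : + p ∣ₛ u * u * qf a b c ⟦ 1ℤ , + t ⟧
    p∣uuQ[1,t] = subst (+ p ∣ₛ_) (complete-square a b c u v (+ t)) (∣m∣n⇒∣m+n p∣Q (∣m⇒∣m*n _ p∣ut-v))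

  quadratic-cover : ∀ Q → Cover (λ x → + p ∣ₛ Q ⟦ x ⟧) 2
  quadratic-cover Q@(qf a b c) with + p ∣ₛ.∣? c
  ... | yes p∣c = product-cover Q (1ℤ , 0ℤ) (a , b) λ (u , v) →
    subst (+ p ∣ₛ_) (sym (factor-∞ a b c u v)) (∣m⇒∣m*n (v * v) p∣c)
    where
    factor-∞ : ∀ a b c u v →
      a * u * u + b * u * v + c * v * v - (1ℤ * u + 0ℤ * v) * (a * u + b * v) ≡ c * (v * v)
    factor-∞ = solve-∀
  ... | no p∤c with anyUpTo? (λ t → + p ∣ₛ.∣? Q ⟦ 1ℤ , + t ⟧) p
  ...   | yes (t , _ , p∣Q[1,t]) = product-cover Q (- + t , 1ℤ) (b + c * + t , c) λ (u , v) →
    subst (+ p ∣ₛ_) (sym (factor-t a b c u v (+ t))) (∣m⇒∣m*n (u * u) p∣Q[1,t])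
    where
    factor-t : ∀ a b c u v t →
      a * u * u + b * u * v + c * v * v - (- t * u + 1ℤ * v) * ((b + c * t) * u + c * v)
        ≡ (a * 1ℤ * 1ℤ + b * 1ℤ * t + c * t * t) * (u * u)
    factor-t = solve-∀
  ...   | no no-root = Cover-weaken (ℕ.n≤1+n 1) (cover-diagonal +p≢0 +p≢0 λ u v →
    mk⇔ (∣-anisotropic⇒∣-arguments {a} {b} p∤c no-root) (λ (p∣u , p∣v) → ∣-arguments⇒∣-value Q p∣u p∣v))

-- Induction on the prime factorisation

CongruenceCover : ℕ → ℕ → Set
CongruenceCover k e = ∀ Q → Cover (λ x → + k ∣ₛ Q ⟦ x ⟧) (2 ^ e)

congruenceCover-1 : CongruenceCover 1 0
congruenceCover-1 Q = cover-everything λ x → 1∣ (Q ⟦ x ⟧)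

congruenceCover-prime-* : ∀ {p k e} → Prime p → CongruenceCover k e → CongruenceCover (p ℕ.* k) (suc e)
congruenceCover-prime-* {p} {k} {e} p-prime cover-k Q = Cover-resp-⇔ forget-∈
  (Cover-weaken (ℕ.*-monoˡ-≤ (2 ^ e) length≤) (cover-⋃ lattices cover-on λ x → from (spec x)))
  where
  open Cover (quadratic-cover p-prime Q)
  instance
    +p-nonZero : ℤ.NonZero (+ p)
    +p-nonZero = prime⇒nonZero p-prime
  forget-∈ : ∀ x → (x ∈ᴸ lattices × + (p ℕ.* k) ∣ₛ Q ⟦ x ⟧) ⇔ + (p ℕ.* k) ∣ₛ Q ⟦ x ⟧
  forget-∈ x = mk⇔ proj₂ λ pk∣Q → to (spec x) (∣ₛ.∣-trans (∣ᵤ⇒∣ (ℕ.∣m⇒∣m*n k ℕ.∣-refl)) pk∣Q) , pk∣Q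
  cover-on : ∀ M → (∀ x → x ∈L M → + p ∣ₛ Q ⟦ x ⟧) →
             Cover (λ x → x ∈L M × + (p ℕ.* k) ∣ₛ Q ⟦ x ⟧) (2 ^ e)
  cover-on M M⊆ = cover-restrict M (Cover-resp-⇔ k∣⇔pk∣ (cover-k Q′))
    where
    Q∘M-multiple : ∃ λ Q′ → ∀ y → Q ∘Q M ⟦ y ⟧ ≡ + p * Q′ ⟦ y ⟧
    Q∘M-multiple = ∣-values⇒multiple (Q ∘Q M) λ y → subst (+ p ∣ₛ_) (sym (∘Q-⟦⟧ Q M y)) (M⊆ _ (⟨⟩∈L M y))
    Q′ = proj₁ Q∘M-multiple
    k∣⇔pk∣ : ∀ y → + k ∣ₛ Q′ ⟦ y ⟧ ⇔ + (p ℕ.* k) ∣ₛ Q ⟦ M ⟨ y ⟩ ⟧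
    k∣⇔pk∣ y = subst₂ (λ d z → + k ∣ₛ Q′ ⟦ y ⟧ ⇔ d ∣ₛ z)
      (sym (ℤ.pos-* p k)) (trans (sym (proj₂ Q∘M-multiple y)) (∘Q-⟦⟧ Q M y))
      (mk⇔ (∣ₛ.*-monoʳ-∣ (+ p)) (∣ₛ.*-cancelˡ-∣ (+ p)))

module _ (S : ℕ → ℕ → Set) (S-1 : S 1 0)
         (S-prime-* : ∀ {p n e} → Prime p → S n e → S (p ℕ.* n) (suc e)) where

  private
    S-≤1 : ∀ {n} .{{_ : NonZero n}} → n ≤ 1 → S n 0
    S-≤1 {n} n≤1 = subst (λ m → S m 0) (ℕ.≤-antisym (ℕ.>-nonZero⁻¹ n) n≤1) S-1

    -- Every step spends one unit of fuel and
    -- either increments k or replaces n by n / (k + 2) < n, so 2 n ≤ f + k is preserved; once the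
    -- fuel is gone it forces n ≤ 1, since a (k + 2)-rough n > 1 is at least k + 2.
    ΩAux-induction : ∀ f n k .{{_ : NonZero n}} → (2 ℕ.+ k) Rough n → 2 ℕ.* n ≤ f ℕ.+ k →
                     S n (ΩAux f n k)
    ΩAux-induction zero n k rough fuel = S-≤1 (ℕ.≮⇒≥ λ 1<n → ℕ.<-irrefl refl (begin-strict
      k        <⟨ ℕ.m<n+m k (ℕ.s≤s ℕ.z≤n) ⟩
      2 ℕ.+ k  ≤⟨ rough⇒≤ {{ℕ.n>1⇒nonTrivial 1<n}} rough ⟩
      n        ≤⟨ ℕ.m≤m+n n (n ℕ.+ 0) ⟩
      2 ℕ.* n  ≤⟨ fuel ⟩
      k        ∎))
      where open ℕ.≤-Reasoning
    ΩAux-induction (suc f) n k rough fuel with n ℕ.≤? 1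
    ... | yes n≤1 = S-≤1 n≤1
    ... | no _ with suc (suc k) ℕ.∣? n
    ...   | no d∤n =
      ΩAux-induction f n (suc k) (∤⇒rough-suc d∤n rough) (subst (2 ℕ.* n ≤_) (sym (ℕ.+-suc f k)) fuel)
    ...   | yes d∣n = subst (λ m → S m (suc (ΩAux f (n / d) k))) (m*[n/m]≡n d∣n)
      (S-prime-* (rough∧∣⇒prime rough d∣n)
                 (ΩAux-induction f (n / d) k {{n/d≢0}} (rough∧∣⇒rough rough (ℕ.m/n∣m d∣n)) fuel′))
      where
      d = suc (suc k)
      n/d≢0 : NonZero (n / d)
      n/d≢0 = ℕ.>-nonZero (m≥n⇒m/n>0 (ℕ.∣⇒≤ d∣n))
      fuel′ : 2 ℕ.* (n / d) ≤ f ℕ.+ k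
      fuel′ = ℕ.≤-pred (ℕ.<-≤-trans (ℕ.*-monoʳ-< 2 (m/n<m n d (ℕ.s≤s (ℕ.s≤s ℕ.z≤n)))) fuel)

  Ω-induction : ∀ n .{{_ : NonZero n}} → S n (Ω n)
  Ω-induction n = ΩAux-induction (2 ℕ.* n) n 0 2-rough (ℕ.m≤m+n (2 ℕ.* n) 0)

lemma6 : (Q : QuadForm) (r : ℕ) → .{{_ : NonZero r}} →
    Σ (List Lattice) λ Λs →
      (length Λs ≤ 2 ^ Ω r) ×
      ((u v : ℤ) → ((+ r) ∣ evalQ Q u v) ⇔ Any (λ Λ → (u , v) ∈L Λ) Λs)
lemma6 Q r = lattices , length≤ , λ u v → mk⇔ (to (spec (u , v)) ∘ ∣ᵤ⇒∣) (∣⇒∣ᵤ ∘ from (spec (u , v)))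
  where
  open Cover (Ω-induction CongruenceCover congruenceCover-1
                          (λ {p k e} → congruenceCover-prime-* {p} {k} {e}) r Q)
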